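{- For every integer $n\ge 0$, there is a bijection between the set of isomorphism classes of $XY$-graphs on $n$ vertices with no isolates in $Y$ and the set of isomorphism classes of minimal set covers of an $n$-element set which maps unbalanced $XY$-graphs to unbalanced minimal set covers and balanced $XY$-graphs to balanced minimal set covers.
   Context: An $XY$-graph is a bipartite graph with a specified ordered bipartition $X\cup Y$ of its vertices (edges join $X$ to $Y$); isomorphisms must map $X$ onto $X'$ and $Y$ onto $Y'$. A vertex of $Y$ is an isolate if it has no neighbor; a vertex of $X$ is universal if it is adjacent to every vertex of $Y$. An $XY$-graph with no isolates in $Y$ is unbalanced if $X$ has a universal vertex and balanced otherwise. A set cover of a finite set $V$ is a collection $\mathcal{C}$ of subsets of $V$ with union $V$; it is minimal if no member is contained in the union of the others. A minimal set cover is unbalanced if it contains a set of cardinality $|V|-|\mathcal{C}|+1$, and balanced otherwise. Set covers are identified under bijections of ground sets carrying members onto members. -}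

module Defs where

open import Data.Nat using (ℕ; _+_; suc)
open import Data.Bool using (Bool; true)
open import Data.Fin using (Fin)
open import Data.Fin.Subset using (Subset; _∈_; ∣_∣)
open import Data.Product using (Σ; ∃; ∃-syntax; _×_)
open import Function.Bundles using (_↔_; Inverse)
open import Function.Definitions using (Injective)
open import Relation.Binary.PropositionalEquality using (_≡_; _≢_)
open import Relation.Nullary using (¬_)
open import Data.Product using (_,_)

record XYGraph (n : ℕ) : Set where
  field
    xs   : ℕ
    ys   : ℕ
    size : xs + ys ≡ n
    adj  : Fin xs → Fin ys → Bool
open XYGraph public

_≅G_ : ∀ {n} → XYGraph n → XYGraph n → Set
G ≅G H =
  Σ (Fin (xs G) ↔ Fin (xs H)) λ σ →
  Σ (Fin (ys G) ↔ Fin (ys H)) λ τ →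
    ∀ x y → adj G x y ≡ adj H (Inverse.to σ x) (Inverse.to τ y)

NoIsolates : ∀ {n} → XYGraph n → Set
NoIsolates G = ∀ y → ∃[ x ] adj G x y ≡ true

UnbalancedG : ∀ {n} → XYGraph n → Set
UnbalancedG G = ∃[ x ] (∀ y → adj G x y ≡ true)

BalancedG : ∀ {n} → XYGraph n → Set
BalancedG G = ¬ UnbalancedG G

XYGraphNI : ℕ → Set
XYGraphNI n = Σ (XYGraph n) NoIsolates

record SetFamily (n : ℕ) : Set where
  field
    size    : ℕ
    member  : Fin size → Subset n
    distinct : Injective _≡_ _≡_ member
open SetFamily public

IsCover : ∀ {n} → SetFamily n → Set
IsCover C = ∀ v → ∃[ i ] v ∈ member C i

ContainedInOthers : ∀ {n} → (C : SetFamily n) → Fin (size C) → Set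
ContainedInOthers C i = ∀ v → v ∈ member C i → ∃[ j ] (j ≢ i × v ∈ member C j)

IsMinimalCover : ∀ {n} → SetFamily n → Set
IsMinimalCover C = IsCover C × (∀ i → ¬ ContainedInOthers C i)

MinimalSetCover : ℕ → Set
MinimalSetCover n = Σ (SetFamily n) IsMinimalCover

_≅C_ : ∀ {n} → SetFamily n → SetFamily n → Set
_≅C_ {n} C D =
  Σ (Fin n ↔ Fin n) λ π →
  Σ (Fin (size C) ↔ Fin (size D)) λ ρ →
    ∀ i v → (v ∈ member C i → Inverse.to π v ∈ member D (Inverse.to ρ i))
          × (Inverse.to π v ∈ member D (Inverse.to ρ i) → v ∈ member C i)

-- unbalanced: some member has cardinality |V| - |C| + 1
-- (stated as |S| + |C| = |V| + 1, avoiding truncated subtraction)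
UnbalancedC : ∀ {n} → SetFamily n → Set
UnbalancedC {n} C = ∃[ i ] ∣ member C i ∣ + size C ≡ suc n

BalancedC : ∀ {n} → SetFamily n → Set
BalancedC C = ¬ UnbalancedC C

module Submission where

-- The cover of G has one member per x ∈ X, the closed neighbourhood N[x] = {x} ∪ N(x)
-- inside V = X ⊎ Y; it is a cover since Y has no isolates, and it is minimal because x
-- is private to N[x].
--   * Well defined: a graph isomorphism (σ, τ) carries N[x] onto N[σ x].
--   * Injective: a cover isomorphism (π, ρ) need not map X onto X′, but it sends x
--     either to ρ x or into Y′; correcting π by the swaps π x ↔ ρ x (SumCancellation)
--     gives a bijection τ : Y ↔ Y′ with (ρ, τ) a graph isomorphism.
--   * Surjective: choose a private vertex in each member of a minimal cover, let X be
--     the chosen vertices (Partition, same-image-↔) and Y the rest; the cover of the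
--     resulting graph is the given one.
--   * Balance: |N[x]| = 1 + deg x, so N[x] has size |V| - |X| + 1 iff x is universal.

open import Defs
open import Data.Nat using (ℕ; zero; suc; _+_)
open import Data.Nat.Properties using (+-comm; +-cancelʳ-≡; suc-injective)
open import Data.Bool using (Bool; true; false)
open import Data.Bool.Properties using (⇔→≡)
open import Data.Fin using (Fin; zero; suc; splitAt; cast)
open import Data.Fin.Properties using (+↔⊎; cast-involutive; cast-is-id; _≟_; any?; ¬∀⟶∃¬)
open import Data.Fin.Permutation using (↔⇒≡)
open import Data.Fin.Subset using (Subset; _∈_; ∣_∣; ⁅_⁆)
open import Data.Fin.Subset.Properties using (x∈⁅y⁆⇔x≡y; ∣⁅x⁆∣≡1; ∈⊤; ⊆⊤; ⊆-antisym; ∣⊤∣≡n; ∣p∣≡n⇒p≡⊤; _∈?_)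
open import Data.Vec using (tabulate; lookup)
open import Data.Vec.Properties using (lookup∘tabulate; tabulate∘lookup; tabulate-cong; []=⇒lookup; lookup⇒[]=)
open import Data.Sum using (_⊎_; inj₁; inj₂; map₁)
open import Data.Sum.Properties using (inj₁-injective; inj₂-injective; swap-↔)
open import Data.Sum.Function.Propositional using (_⊎-↔_)
open import Data.Product using (Σ; _×_; _,_; proj₁; proj₂; ∃; ∃-syntax; uncurry)
open import Data.Empty using (⊥-elim)
open import Function using (_∘_)
open import Function.Bundles using (_↔_; _⇔_; Inverse; Injection; Equivalence; mk↔ₛ′; mk⇔)
open import Function.Definitions using (Injective)
open import Function.Properties.Inverse using (↔-refl; ↔-sym; ↔-trans; ↔⇒↣)
open import Function.Properties.Equivalence using () renaming (trans to ⇔-trans; sym to ⇔-sym)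
open import Function.Related.TypeIsomorphisms using (⊎-assoc)
open import Level using (0ℓ)
open import Relation.Binary.PropositionalEquality
open import Relation.Nullary using (¬_; yes; no)
open import Relation.Nullary.Decidable using (¬?; _×-dec_; _→-dec_; decidable-stable)
open import Relation.Unary using (Decidable)

open Inverse using (to; from; strictlyInverseˡ; strictlyInverseʳ; inverseˡ; inverseʳ)

∈⇔lookup : ∀ {n} {v : Fin n} {s : Subset n} → v ∈ s ⇔ lookup s v ≡ true
∈⇔lookup {v = v} {s} = mk⇔ []=⇒lookup (lookup⇒[]= v s)

∈-tabulate : ∀ {n} {v : Fin n} (f : Fin n → Bool) → v ∈ tabulate f ⇔ f v ≡ true
∈-tabulate {v = v} f = subst (λ b → v ∈ tabulate f ⇔ b ≡ true) (lookup∘tabulate f v) ∈⇔lookup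

⁅⁆-spec : ∀ {n} {x y : Fin n} → lookup ⁅ x ⁆ y ≡ true ⇔ y ≡ x
⁅⁆-spec = ⇔-trans (⇔-sym ∈⇔lookup) x∈⁅y⁆⇔x≡y

⁅⁆-self : ∀ {n} (x : Fin n) → lookup ⁅ x ⁆ x ≡ true
⁅⁆-self x = Equivalence.from (⁅⁆-spec {x = x} {y = x}) refl

⁅⁆-injective : ∀ {m n} {f : Fin m → Fin n} → Injective _≡_ _≡_ f →
               ∀ x y → lookup ⁅ f x ⁆ (f y) ≡ lookup ⁅ x ⁆ y
⁅⁆-injective {f = f} f-inj x y =
  ⇔→≡ (⇔-trans ⁅⁆-spec (⇔-trans (mk⇔ f-inj (cong f)) (⇔-sym ⁅⁆-spec)))

full⇔∣∣ : ∀ {n} (p : Subset n) → (∀ v → v ∈ p) ⇔ ∣ p ∣ ≡ n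
full⇔∣∣ {n} p = mk⇔ (λ all → trans (cong ∣_∣ (⊆-antisym ⊆⊤ (λ {v} _ → all v))) (∣⊤∣≡n n))
                    (λ full v → subst (v ∈_) (sym (∣p∣≡n⇒p≡⊤ full)) ∈⊤)

cast-↔ : ∀ {m n} → m ≡ n → Fin m ↔ Fin n
cast-↔ eq = mk↔ₛ′ (cast eq) (cast (sym eq)) (cast-involutive eq (sym eq)) (cast-involutive (sym eq) eq)

to-injective : ∀ {A B : Set} (f : A ↔ B) {x y} → to f x ≡ to f y → x ≡ y
to-injective f = Injection.injective (↔⇒↣ f)

-- Let π : A ⊎ B ↔ A′ ⊎ B′ and ρ : A ↔ A′ be such that
-- π sends each a ∈ A either to ρ a or into B′.  Then π can be corrected to a bijection
-- B ↔ B′: b goes to π b if that lies in B′, and otherwise, when π b = ρ a, to π a.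
module SumCancellation {A B A′ B′ : Set} (π : (A ⊎ B) ↔ (A′ ⊎ B′)) (ρ : A ↔ A′) where

  Respects : Set
  Respects = ∀ a k → to π (inj₁ a) ≡ inj₁ k → k ≡ to ρ a

  _↦_ : B → B′ → Set
  b ↦ c = to π (inj₂ b) ≡ inj₂ c
        ⊎ ∃[ a ] (to π (inj₂ b) ≡ inj₁ (to ρ a) × to π (inj₁ a) ≡ inj₂ c)

  ↦-functional : ∀ {b c c′} → b ↦ c → b ↦ c′ → c ≡ c′
  ↦-functional (inj₁ e) (inj₁ e′) = inj₂-injective (trans (sym e) e′)
  ↦-functional (inj₁ e) (inj₂ (_ , e′ , _)) with () ← trans (sym e) e′
  ↦-functional (inj₂ (_ , e , _)) (inj₁ e′) with () ← trans (sym e) e′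
  ↦-functional (inj₂ (a , e₁ , e₂)) (inj₂ (a′ , e₁′ , e₂′))
    with refl ← to-injective ρ (inj₁-injective (trans (sym e₁) e₁′))
    = inj₂-injective (trans (sym e₂) e₂′)

  ↦-total : Respects → ∀ b → ∃[ c ] b ↦ c
  ↦-total respects b with to π (inj₂ b) in e
  ... | inj₂ c = c , inj₁ refl
  ... | inj₁ k with to π (inj₁ (from ρ k)) in e′
  ...   | inj₂ c = c , inj₂ (from ρ k , cong inj₁ (sym (strictlyInverseˡ ρ k)) , e′)
  ...   | inj₁ k′ = ⊥-elim (inj₁≢inj₂ (to-injective π (trans e′ (trans (cong inj₁ k′≡k) (sym e)))))
    where
    k′≡k : k′ ≡ k
    k′≡k = trans (respects _ k′ e′) (strictlyInverseˡ ρ k)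
    inj₁≢inj₂ : inj₁ (from ρ k) ≢ inj₂ b
    inj₁≢inj₂ ()

module SumCancellationInverse {A B A′ B′ : Set} (π : (A ⊎ B) ↔ (A′ ⊎ B′)) (ρ : A ↔ A′) where
  open SumCancellation π ρ
  private module Inv = SumCancellation (↔-sym π) (↔-sym ρ)

  respects-sym : Respects → Inv.Respects
  respects-sym respects k a e = sym (inverseʳ ρ (respects a k (inverseˡ π (sym e))))

  ↦-sym : ∀ {b c} → b ↦ c → c Inv.↦ b
  ↦-sym (inj₁ e)               = inj₁ (inverseʳ π (sym e))
  ↦-sym (inj₂ (a , e₁ , e₂)) = inj₂ (to ρ a ,
    trans (inverseʳ π (sym e₂)) (cong inj₁ (sym (strictlyInverseʳ ρ a))) ,
    inverseʳ π (sym e₁))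

sum-cancellation : ∀ {A B A′ B′ : Set} (π : (A ⊎ B) ↔ (A′ ⊎ B′)) (ρ : A ↔ A′) →
                   SumCancellation.Respects π ρ →
                   Σ (B ↔ B′) λ τ → ∀ b → SumCancellation._↦_ π ρ b (to τ b)
sum-cancellation π ρ respects = τ , λ b → proj₂ (image b)
  where
  open SumCancellation π ρ
  module Inv = SumCancellation (↔-sym π) (↔-sym ρ)
  open SumCancellationInverse using (respects-sym; ↦-sym)
  image : ∀ b → ∃ (b ↦_)
  image = ↦-total respects
  preimage : ∀ c → ∃ (c Inv.↦_)
  preimage = Inv.↦-total (respects-sym π ρ respects)
  τ : _ ↔ _
  τ = mk↔ₛ′ (proj₁ ∘ image) (proj₁ ∘ preimage)
        (λ c → ↦-functional (proj₂ (image _)) (↦-sym (↔-sym π) (↔-sym ρ) (proj₂ (preimage c))))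
        (λ b → Inv.↦-functional (proj₂ (preimage _)) (↦-sym π ρ (proj₂ (image b))))

record Partition {n} (P : Fin n → Set) : Set where
  field
    {inner outer} : ℕ
    split   : Fin n ↔ (Fin inner ⊎ Fin outer)
    inside  : ∀ a → P (from split (inj₁ a))
    outside : ∀ b → ¬ P (from split (inj₂ b))

  sizes : inner + outer ≡ n
  sizes = sym (↔⇒≡ (↔-trans split (↔-sym +↔⊎)))

  enumerated : ∀ {v} → P v → ∃[ a ] from split (inj₁ a) ≡ v
  enumerated {v} Pv with to split v in e
  ... | inj₁ a = a , inverseʳ split (sym e)
  ... | inj₂ b = ⊥-elim (outside b (subst P (sym (inverseʳ split (sym e))) Pv))

-- Fin (1 + n) ≅ Fin 1 ⊎ Fin n ≅ Fin 1 ⊎ (Fin k ⊎ B) ≅ Fin (1 + k) ⊎ B, with 0 ↦ inj₁ 0.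
extend : ∀ {n k} {B : Set} → Fin n ↔ (Fin k ⊎ B) → Fin (suc n) ↔ (Fin (suc k) ⊎ B)
extend f = ↔-trans (+↔⊎ {1}) (↔-trans (↔-refl ⊎-↔ f)
             (↔-trans (↔-sym (⊎-assoc 0ℓ _ _ _)) (↔-sym +↔⊎ ⊎-↔ ↔-refl)))

partition : ∀ {n} {P : Fin n → Set} → Decidable P → Partition P
partition {zero}  P? = record { split = +↔⊎ {0} {0} ; inside = λ () ; outside = λ () }
partition {suc n} P? with P? zero | partition (P? ∘ suc)
... | yes P0 | record { split = f ; inside = in′ ; outside = out′ } = record
  { split   = extend f
  ; inside  = λ { zero → P0 ; (suc a) → in′ a }
  ; outside = out′
  }
... | no ¬P0 | record { split = f ; inside = in′ ; outside = out′ } = record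
  { split   = ↔-trans (extend (↔-trans f swap-↔)) swap-↔
  ; inside  = in′
  ; outside = λ { zero → ¬P0 ; (suc b) → out′ b }
  }

same-image-↔ : ∀ {A B C : Set} {f : A → C} {g : B → C} → Injective _≡_ _≡_ f → Injective _≡_ _≡_ g →
               (∀ a → ∃[ b ] g b ≡ f a) → (∀ b → ∃[ a ] f a ≡ g b) →
               Σ (A ↔ B) λ ρ → ∀ a → g (to ρ a) ≡ f a
same-image-↔ {f = f} {g} f-inj g-inj f⊆g g⊆f = ρ , proj₂ ∘ f⊆g
  where
  ρ : _ ↔ _
  ρ = mk↔ₛ′ (proj₁ ∘ f⊆g) (proj₁ ∘ g⊆f)
        (λ b → g-inj (trans (proj₂ (f⊆g _)) (proj₂ (g⊆f b))))
        (λ a → f-inj (trans (proj₂ (g⊆f _)) (proj₂ (f⊆g a))))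

count-splitAt : ∀ a {b} (g : Fin a ⊎ Fin b → Bool) →
  ∣ tabulate (g ∘ splitAt a) ∣ ≡ ∣ tabulate (g ∘ inj₁) ∣ + ∣ tabulate (g ∘ inj₂) ∣
count-splitAt zero    g = refl
count-splitAt (suc a) g with g (inj₁ zero) | count-splitAt a (g ∘ map₁ suc)
... | true  | count = cong suc count
... | false | count = count

count-cast : ∀ {m n} (eq : m ≡ n) (f : Fin n → Bool) → ∣ tabulate (f ∘ cast eq) ∣ ≡ ∣ tabulate f ∣
count-cast refl f = cong ∣_∣ (tabulate-cong (λ v → cong f (cast-is-id refl v)))

Vertex : ∀ {n} → XYGraph n → Set
Vertex G = Fin (xs G) ⊎ Fin (ys G)

-- The identification V = Fin n ≅ X ⊎ Y underlying G.
ground : ∀ {n} (G : XYGraph n) → Fin n ↔ Vertex G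
ground G = ↔-trans (cast-↔ (sym (XYGraph.size G))) +↔⊎

closedNbhd : ∀ {a b} → (Fin a → Fin b → Bool) → Fin a → Fin a ⊎ Fin b → Bool
closedNbhd E x (inj₁ x′) = lookup ⁅ x ⁆ x′
closedNbhd E x (inj₂ y)  = E x y

nbhd : ∀ {n} (G : XYGraph n) → Fin (xs G) → Subset n
nbhd G x = tabulate (closedNbhd (adj G) x ∘ to (ground G))

∈-nbhd : ∀ {n} (G : XYGraph n) {x} (v : Fin n) →
         v ∈ nbhd G x ⇔ closedNbhd (adj G) x (to (ground G) v) ≡ true
∈-nbhd G v = ∈-tabulate _

∈-nbhd-from : ∀ {n} (G : XYGraph n) {x} (s : Vertex G) →
              from (ground G) s ∈ nbhd G x ⇔ closedNbhd (adj G) x s ≡ true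
∈-nbhd-from G {x} s = subst (λ t → from (ground G) s ∈ nbhd G x ⇔ closedNbhd (adj G) x t ≡ true)
                            (strictlyInverseˡ (ground G) s) (∈-nbhd G _)

own-vertex-∈ : ∀ {n} (G : XYGraph n) x → from (ground G) (inj₁ x) ∈ nbhd G x
own-vertex-∈ G x = Equivalence.from (∈-nbhd-from G (inj₁ x)) (⁅⁆-self x)

own-vertex-private : ∀ {n} (G : XYGraph n) {x x′} → from (ground G) (inj₁ x) ∈ nbhd G x′ → x ≡ x′
own-vertex-private G e = Equivalence.to ⁅⁆-spec (Equivalence.to (∈-nbhd-from G (inj₁ _)) e)

-- The closed neighbourhoods are pairwise distinct, as each contains its own centre only.
coverOf : ∀ {n} → XYGraph n → SetFamily n
coverOf G = record
  { size     = xs G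
  ; member   = nbhd G
  ; distinct = λ {x} eq → own-vertex-private G (subst (_ ∈_) eq (own-vertex-∈ G x))
  }

coverOf-minimal : ∀ {n} (G : XYGraph n) → NoIsolates G → IsMinimalCover (coverOf G)
coverOf-minimal G noIsolates = covers , minimal
  where
  covering-index : ∀ s → ∃[ x ] closedNbhd (adj G) x s ≡ true
  covering-index (inj₁ x) = x , ⁅⁆-self x
  covering-index (inj₂ y) = noIsolates y

  covers : IsCover (coverOf G)
  covers v with covering-index (to (ground G) v)
  ... | x , e = x , subst (_∈ nbhd G x) (strictlyInverseʳ (ground G) v)
                          (Equivalence.from (∈-nbhd-from G (to (ground G) v)) e)

  minimal : ∀ x → ¬ ContainedInOthers (coverOf G) x
  minimal x contained with contained _ (own-vertex-∈ G x)
  ... | x′ , x′≢x , e = x′≢x (sym (own-vertex-private G e))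

cover : ∀ {n} → XYGraphNI n → MinimalSetCover n
cover (G , noIsolates) = coverOf G , coverOf-minimal G noIsolates

coverOf-≅ : ∀ {n} (G : XYGraph n) (C : SetFamily n)
            (ψ : Vertex G ↔ Fin n) (ρ : Fin (xs G) ↔ Fin (size C)) →
            (∀ x s → closedNbhd (adj G) x s ≡ true ⇔ to ψ s ∈ member C (to ρ x)) →
            coverOf G ≅C C
coverOf-≅ G C ψ ρ carries = ↔-trans (ground G) ψ , ρ , λ x v →
  let v∈⇔ = ⇔-trans (∈-nbhd G v) (carries x (to (ground G) v))
  in Equivalence.to v∈⇔ , Equivalence.from v∈⇔

closedNbhd-≅ : ∀ {n} {G H : XYGraph n} ((σ , τ , _) : G ≅G H) x s →
               closedNbhd (adj G) x s ≡ closedNbhd (adj H) (to σ x) (to (σ ⊎-↔ τ) s)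
closedNbhd-≅ (σ , τ , _)         x (inj₁ x′) = sym (⁅⁆-injective (to-injective σ) x x′)
closedNbhd-≅ (σ , τ , preserves) x (inj₂ y)  = preserves x y

coverOf-preserves-≅ : ∀ {n} (G H : XYGraph n) → G ≅G H → coverOf G ≅C coverOf H
coverOf-preserves-≅ G H iso@(σ , τ , _) =
  coverOf-≅ G (coverOf H) (↔-trans (σ ⊎-↔ τ) (↔-sym (ground H))) σ λ x s →
    subst (λ b → b ≡ true ⇔ from (ground H) (to (σ ⊎-↔ τ) s) ∈ nbhd H (to σ x))
          (sym (closedNbhd-≅ {G = G} {H} iso x s)) (⇔-sym (∈-nbhd-from H (to (σ ⊎-↔ τ) s)))

-- The core of injectivity: a bijection π of X ⊎ Y with X′ ⊎ Y′ that carries every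
-- closed neighbourhood N[x] onto N′[ρ x] yields an isomorphism (ρ, τ) of the graphs,
-- even though π itself need not map X onto X′.
closedNbhd-rigid : ∀ {a b a′ b′} (E : Fin a → Fin b → Bool) (E′ : Fin a′ → Fin b′ → Bool)
  (π : (Fin a ⊎ Fin b) ↔ (Fin a′ ⊎ Fin b′)) (ρ : Fin a ↔ Fin a′) →
  (∀ x s → closedNbhd E x s ≡ closedNbhd E′ (to ρ x) (to π s)) →
  Σ (Fin b ↔ Fin b′) λ τ → ∀ x y → E x y ≡ E′ (to ρ x) (to τ y)
closedNbhd-rigid {b = b} {b′ = b′} E E′ π ρ carried = τ , adjacency
  where
  open SumCancellation π ρ
  open ≡-Reasoning

  -- x ∈ N[x], so π x ∈ N′[ρ x]; inside X′ that forces π x = ρ x.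
  respects : Respects
  respects a k e = Equivalence.to ⁅⁆-spec (begin
    lookup ⁅ to ρ a ⁆ k                      ≡⟨ cong (closedNbhd E′ (to ρ a)) e ⟨
    closedNbhd E′ (to ρ a) (to π (inj₁ a))   ≡⟨ carried a (inj₁ a) ⟨
    lookup ⁅ a ⁆ a                           ≡⟨ ⁅⁆-self a ⟩
    true                                     ∎)

  τ : Fin b ↔ Fin b′
  τ = proj₁ (sum-cancellation π ρ respects)

  adjacency : ∀ x y → E x y ≡ E′ (to ρ x) (to τ y)
  adjacency x y with proj₂ (sum-cancellation π ρ respects) y
  ... | inj₁ e = begin
    E x y                                    ≡⟨ carried x (inj₂ y) ⟩
    closedNbhd E′ (to ρ x) (to π (inj₂ y))   ≡⟨ cong (closedNbhd E′ (to ρ x)) e ⟩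
    E′ (to ρ x) (to τ y)                     ∎
  ... | inj₂ (a , e₁ , e₂) = begin
    E x y                                    ≡⟨ carried x (inj₂ y) ⟩
    closedNbhd E′ (to ρ x) (to π (inj₂ y))   ≡⟨ cong (closedNbhd E′ (to ρ x)) e₁ ⟩
    lookup ⁅ to ρ x ⁆ (to ρ a)               ≡⟨ ⁅⁆-injective (to-injective ρ) x a ⟩
    lookup ⁅ x ⁆ a                           ≡⟨ carried x (inj₁ a) ⟩
    closedNbhd E′ (to ρ x) (to π (inj₁ a))   ≡⟨ cong (closedNbhd E′ (to ρ x)) e₂ ⟩
    E′ (to ρ x) (to τ y)                     ∎

coverOf-reflects-≅ : ∀ {n} (G H : XYGraph n) → coverOf G ≅C coverOf H → G ≅G H
coverOf-reflects-≅ G H (π , ρ , carries) = ρ , closedNbhd-rigid (adj G) (adj H) πᵥ ρ carried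
  where
  πᵥ : Vertex G ↔ Vertex H
  πᵥ = ↔-trans (↔-sym (ground G)) (↔-trans π (ground H))

  carried : ∀ x s → closedNbhd (adj G) x s ≡ closedNbhd (adj H) (to ρ x) (to πᵥ s)
  carried x s = ⇔→≡ (⇔-trans (⇔-sym (∈-nbhd-from G s))
                    (⇔-trans (uncurry mk⇔ (carries x (from (ground G) s))) (∈-nbhd H _)))

degree : ∀ {n} (G : XYGraph n) → Fin (xs G) → ℕ
degree G x = ∣ tabulate (adj G x) ∣

∣nbhd∣ : ∀ {n} (G : XYGraph n) x → ∣ nbhd G x ∣ ≡ suc (degree G x)
∣nbhd∣ G x = begin
  ∣ nbhd G x ∣                                       ≡⟨ count-cast (sym (XYGraph.size G)) _ ⟩
  ∣ tabulate (closedNbhd (adj G) x ∘ splitAt (xs G)) ∣ ≡⟨ count-splitAt (xs G) (closedNbhd (adj G) x) ⟩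
  ∣ tabulate (lookup ⁅ x ⁆) ∣ + degree G x            ≡⟨ cong (λ s → ∣ s ∣ + degree G x) (tabulate∘lookup ⁅ x ⁆) ⟩
  ∣ ⁅ x ⁆ ∣ + degree G x                              ≡⟨ cong (_+ degree G x) (∣⁅x⁆∣≡1 x) ⟩
  suc (degree G x)                                    ∎
  where open ≡-Reasoning

universal⇔full-degree : ∀ {n} (G : XYGraph n) x → (∀ y → adj G x y ≡ true) ⇔ degree G x ≡ ys G
universal⇔full-degree G x = mk⇔
  (λ universal → Equivalence.to (full⇔∣∣ _) (λ y → Equivalence.from (∈-tabulate _) (universal y)))
  (λ full y → Equivalence.to (∈-tabulate _) (Equivalence.from (full⇔∣∣ _) full y))

unbalanced-size⇔full-degree : ∀ {n} (G : XYGraph n) x →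
                              ∣ nbhd G x ∣ + xs G ≡ suc n ⇔ degree G x ≡ ys G
unbalanced-size⇔full-degree G x = mk⇔
  (λ e → +-cancelʳ-≡ (xs G) _ _ (suc-injective (trans (sym size-eq) (trans e (cong suc (sym total))))))
  (λ d → trans size-eq (cong suc (trans (cong (_+ xs G) d) total)))
  where
  size-eq : ∣ nbhd G x ∣ + xs G ≡ suc (degree G x + xs G)
  size-eq = cong (_+ xs G) (∣nbhd∣ G x)
  total : ys G + xs G ≡ _
  total = trans (+-comm (ys G) (xs G)) (XYGraph.size G)

unbalanced⇔ : ∀ {n} (G : XYGraph n) → UnbalancedG G ⇔ UnbalancedC (coverOf G)
unbalanced⇔ G = mk⇔
  (λ (x , universal) → x , Equivalence.from (unbalanced-size⇔full-degree G x)
                              (Equivalence.to (universal⇔full-degree G x) universal))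
  (λ (x , unbalanced) → x , Equivalence.from (universal⇔full-degree G x)
                               (Equivalence.to (unbalanced-size⇔full-degree G x) unbalanced))

Private : ∀ {n} (C : SetFamily n) → Fin (size C) → Fin n → Set
Private C i v = v ∈ member C i × (∀ j → v ∈ member C j → j ≡ i)

private-∈⇔ : ∀ {n} {C : SetFamily n} {i v} → Private C i v → ∀ j → v ∈ member C j ⇔ j ≡ i
private-∈⇔ (v∈i , only-i) j = mk⇔ (only-i j) (λ { refl → v∈i })

private-vertex : ∀ {n} (C : SetFamily n) i → ¬ ContainedInOthers C i → ∃ (Private C i)
private-vertex {n} C i not-contained
  with ¬∀⟶∃¬ n _ (λ v → (v ∈? member C i) →-dec any? (λ j → ¬? (j ≟ i) ×-dec (v ∈? member C j)))
             not-contained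
... | v , unshared = v ,
    decidable-stable (v ∈? member C i) (λ v∉i → unshared (λ v∈i → ⊥-elim (v∉i v∈i))) ,
    λ j v∈j → decidable-stable (j ≟ i) (λ j≢i → unshared (λ _ → j , j≢i , v∈j))

-- The XY-graph of a minimal cover C: choose a private vertex p(i) for every member i;
-- X enumerates the chosen vertices, Y the remaining ones, and x = p(i) is joined to
-- y ∈ Y exactly when y lies in member i.
module GraphOf {n} (C : MinimalSetCover n) where
  family : SetFamily n
  family = proj₁ C

  covers : IsCover family
  covers = proj₁ (proj₂ C)

  p : Fin (size family) → Fin n
  p i = proj₁ (private-vertex family i (proj₂ (proj₂ C) i))

  p-private : ∀ i → Private family i (p i)
  p-private i = proj₂ (private-vertex family i (proj₂ (proj₂ C) i))

  p-injective : Injective _≡_ _≡_ p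
  p-injective {i} {j} pi≡pj = proj₂ (p-private j) i (subst (_∈ member family i) pi≡pj (proj₁ (p-private i)))

  chosen : Partition (λ v → ∃[ i ] p i ≡ v)
  chosen = partition (λ v → any? (λ i → p i ≟ v))
  open Partition chosen

  ρ-spec : Σ (Fin inner ↔ Fin (size family)) λ ρ → ∀ a → p (to ρ a) ≡ from split (inj₁ a)
  ρ-spec = same-image-↔ (inj₁-injective ∘ to-injective (↔-sym split)) p-injective
                        inside (λ i → enumerated (i , refl))

  ρ : Fin inner ↔ Fin (size family)
  ρ = proj₁ ρ-spec

  graph : XYGraph n
  graph = record
    { xs = inner ; ys = outer ; size = sizes
    ; adj = λ a b → lookup (member family (to ρ a)) (from split (inj₂ b))
    }

  no-isolates : NoIsolates graph
  no-isolates b with covers (from split (inj₂ b))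
  ... | i , v∈i = from ρ i , Equivalence.to ∈⇔lookup (subst (λ j → _ ∈ member family j) (sym (strictlyInverseˡ ρ i)) v∈i)

  -- N[a] on X: a′ ∈ N[a] iff a′ = a iff p(ρ a′), which lies only in member ρ a′, lies in member ρ a.
  carries : ∀ a s → closedNbhd (adj graph) a s ≡ true ⇔ from split s ∈ member family (to ρ a)
  carries a (inj₂ b)  = ⇔-sym ∈⇔lookup
  carries a (inj₁ a′) = subst (λ v → lookup ⁅ a ⁆ a′ ≡ true ⇔ v ∈ member family (to ρ a)) (proj₂ ρ-spec a′)
    (⇔-trans ⁅⁆-spec (⇔-trans (mk⇔ (cong (to ρ) ∘ sym) (sym ∘ to-injective ρ))
                               (⇔-sym (private-∈⇔ {C = family} (p-private (to ρ a′)) (to ρ a)))))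

  cover-≅ : coverOf graph ≅C family
  cover-≅ = coverOf-≅ graph family (↔-sym split) ρ carries

theorem5p2 : (n : ℕ) →
    Σ (XYGraphNI n → MinimalSetCover n) λ F →
      (∀ (G H : XYGraphNI n) → proj₁ G ≅G proj₁ H → proj₁ (F G) ≅C proj₁ (F H))
      × (∀ (G H : XYGraphNI n) → proj₁ (F G) ≅C proj₁ (F H) → proj₁ G ≅G proj₁ H)
      × (∀ (C : MinimalSetCover n) → Σ (XYGraphNI n) λ G → proj₁ (F G) ≅C proj₁ C)
      × (∀ (G : XYGraphNI n) → UnbalancedG (proj₁ G) → UnbalancedC (proj₁ (F G)))
      × (∀ (G : XYGraphNI n) → BalancedG (proj₁ G) → BalancedC (proj₁ (F G)))
theorem5p2 n = cover
  , (λ G H → coverOf-preserves-≅ (proj₁ G) (proj₁ H))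
  , (λ G H → coverOf-reflects-≅ (proj₁ G) (proj₁ H))
  , (λ C → (GraphOf.graph C , GraphOf.no-isolates C) , GraphOf.cover-≅ C)
  , (λ G → Equivalence.to (unbalanced⇔ (proj₁ G)))
  , (λ G balanced unbalanced → balanced (Equivalence.from (unbalanced⇔ (proj₁ G)) unbalanced))
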